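{- Let $G$ be a graph with $n\ge4$ vertices. If $\Upsilon(G)\not\subseteq[n-3]$, then $G$ is chordal and has no induced path of length $4$.
   Context: All graphs are finite and simple. For a positive integer $p$ and a digraph $D=(V,A)$ with $A\subseteq V\times V$ (loops allowed), the $p$-competition graph $C_p(D)$ has vertex set $V$, and distinct $x,y$ are adjacent iff there are $p$ distinct vertices $a_1,\dots,a_p\in V$ with $(x,a_i),(y,a_i)\in A$ for all $i$. A graph is a $p$-competition graph if it equals $C_p(D)$ for some digraph $D$. For a graph $G$ with $n$ vertices, $[n]=\{1,\dots,n\}$ and $\Upsilon(G)=\{p\in[n]\mid G\text{ is a }p\text{ -competition graph}\}$. A graph is chordal if it has no induced cycle of length at least $4$. An induced path of length $4$ is an induced subgraph isomorphic to the path with $5$ vertices. -}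

module Defs where

open import Data.Nat using (ℕ; suc; _+_; _∸_; _≤_; _<_; _≥_)
open import Data.Fin using (Fin; toℕ)
open import Data.Product using (Σ; _×_; ∃)
open import Data.Sum using (_⊎_)
open import Relation.Nullary using (¬_)
open import Relation.Binary.PropositionalEquality using (_≡_; _≢_)
open import Function.Definitions using (Injective)
open import Function.Bundles using (_⇔_)
open import Level using (0ℓ)

record Graph (n : ℕ) : Set₁ where
  field
    Adj     : Fin n → Fin n → Set
    irrefl  : ∀ x → ¬ Adj x x
    sym     : ∀ x y → Adj x y → Adj y x
open Graph public

-- A digraph on Fin n: an arbitrary arc relation A ⊆ V × V (loops allowed).
Digraph : ℕ → Set₁
Digraph n = Fin n → Fin n → Set

CompeteP : ∀ {n} → ℕ → Digraph n → Fin n → Fin n → Set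
CompeteP {n} p D x y =
  Σ (Fin p → Fin n) λ a → Injective _≡_ _≡_ a × (∀ i → D x (a i) × D y (a i))

IsCp : ∀ {n} → ℕ → Graph n → Digraph n → Set
IsCp p G D = ∀ x y → x ≢ y → (Adj G x y ⇔ CompeteP p D x y)

IsPCompetitionGraph : ∀ {n} → ℕ → Graph n → Set₁
IsPCompetitionGraph {n} p G = Σ (Digraph n) λ D → IsCp p G D

InUpsilon : ∀ {n} → Graph n → ℕ → Set₁
InUpsilon {n} G p = (1 ≤ p) × (p ≤ n) × IsPCompetitionGraph p G

UpsilonSubsetOf : ∀ {n} → Graph n → ℕ → Set₁
UpsilonSubsetOf G m = ∀ p → InUpsilon G p → (1 ≤ p) × (p ≤ m)

CycAdj : ∀ {k} → Fin k → Fin k → Set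
CycAdj {k} i j =
  (suc (toℕ i) ≡ toℕ j) ⊎ (suc (toℕ j) ≡ toℕ i)
  ⊎ ((suc (toℕ i) ≡ k) × (toℕ j ≡ 0)) ⊎ ((suc (toℕ j) ≡ k) × (toℕ i ≡ 0))

PathAdj : ∀ {k} → Fin k → Fin k → Set
PathAdj i j = (suc (toℕ i) ≡ toℕ j) ⊎ (suc (toℕ j) ≡ toℕ i)

HasInducedCycle : ∀ {n} → Graph n → ℕ → Set
HasInducedCycle {n} G k =
  Σ (Fin k → Fin n) λ c → Injective _≡_ _≡_ c × (∀ i j → Adj G (c i) (c j) ⇔ CycAdj i j)

Chordal : ∀ {n} → Graph n → Set
Chordal G = ∀ k → 4 ≤ k → ¬ HasInducedCycle G k

HasInducedPath : ∀ {n} → Graph n → ℕ → Set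
HasInducedPath {n} G k =
  Σ (Fin k → Fin n) λ f → Injective _≡_ _≡_ f × (∀ i j → Adj G (f i) (f j) ⇔ PathAdj i j)

-- induced path of length 4 = induced P₅ (5 vertices)
HasInducedP4 : ∀ {n} → Graph n → Set
HasInducedP4 G = HasInducedPath G 5

-- Let G = Cₚ(D) and let v₀v₁v₂v₃v₄ be a walk in G whose vertices two steps apart are
-- distinct and non-adjacent: an induced P₅, the first five vertices of an induced cycle of
-- length at least 5, or an induced C₄ traversed with v₄ = v₀. Each of the four edges vᵢvᵢ₊₁
-- has at least p common out-neighbours in D, each of the three pairs vᵢvᵢ₊₂ at most p − 1.
-- A single vertex w is a common out-neighbour of at most one more consecutive pair than of
-- pairs two steps apart, so summing over w gives 4p ≤ 3(p − 1) + n, that is p ≤ n − 3.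
-- Deciding the arcs of D is the only classical step; it is harmless since p ≤ n − 3 is decidable.
module Submission where

open import Defs
open import Data.Nat using (ℕ; zero; suc; z≤n; s≤s; _+_; _∸_; _≤_; _<_; _≤?_) renaming (_≟_ to _≟ⁿ_)
open import Data.Nat.Properties
  using (≤ᵇ⇒≤; +-mono-≤; +-monoʳ-≤; +-cancelʳ-≤; +-comm; ≰⇒>; m+n≤o⇒m≤o∸n; module ≤-Reasoning)
open import Data.Nat.Solver using (module +-*-Solver)
open import Data.Bool using (Bool; true; false; _∧_)
open import Data.Empty using (⊥-elim)
open import Data.Fin using (Fin; zero; suc; toℕ; inject≤; #_)
open import Data.Fin.Properties using (injective⇒≤; inject≤-injective) renaming (_≟_ to _≟ᶠ_)
open import Data.List using (List; []; _∷_; length; lookup; filter; allFin)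
open import Data.List.Properties using (length-tabulate)
open import Data.List.Membership.Propositional using (_∈_)
open import Data.List.Membership.Propositional.Properties using (∈-lookup; ∈-filter⁺; ∈-filter⁻; ∈-allFin)
open import Data.List.Relation.Unary.All as All using ()
open import Data.List.Relation.Unary.AllPairs using (_∷_)
open import Data.List.Relation.Unary.Any using (index)
open import Data.List.Relation.Unary.Any.Properties using (lookup-index)
open import Data.List.Relation.Unary.Unique.Propositional using (Unique)
open import Data.List.Relation.Unary.Unique.Propositional.Properties
  using (allFin⁺) renaming (filter⁺ to Unique-filter⁺)
open import Data.Product using (Σ; _×_; _,_; proj₂)
open import Function using (_∘_)
open import Function.Bundles using (_⇔_; mk⇔; module Equivalence)
open import Function.Definitions using (Injective)
open import Level using (Level)
open import Relation.Nullary using (¬_; Dec; does)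
open import Relation.Nullary.Decidable
  using (True; False; toWitness; toWitnessFalse; decidable-stable; ¬¬-excluded-middle; _⊎-dec_; _×-dec_)
open import Relation.Unary using (Pred; Decidable)
open import Relation.Unary.Properties using (_∩?_)
open import Relation.Binary.PropositionalEquality as ≡
  using (_≡_; _≢_; refl; cong; subst; subst₂; module ≡-Reasoning)

module _ {a : Level} {A : Set a} where

  ∈-injection⇒≤-length : ∀ {m} {xs : List A} (f : Fin m → A) →
    Injective _≡_ _≡_ f → (∀ i → f i ∈ xs) → m ≤ length xs
  ∈-injection⇒≤-length {xs = xs} f f-inj f∈xs = injective⇒≤ index-injective
    where
    open ≡-Reasoning
    index-injective : Injective _≡_ _≡_ (λ i → index (f∈xs i))
    index-injective {i} {j} eq = f-inj (begin
      f i                      ≡⟨ lookup-index (f∈xs i) ⟩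
      lookup xs (index (f∈xs i)) ≡⟨ cong (lookup xs) eq ⟩
      lookup xs (index (f∈xs j)) ≡⟨ ≡.sym (lookup-index (f∈xs j)) ⟩
      f j                      ∎)

  lookup-injective : ∀ {xs : List A} → Unique xs → Injective _≡_ _≡_ (lookup xs)
  lookup-injective {_ ∷ _} (_ ∷ _)     {zero}  {zero}  _  = refl
  lookup-injective {_ ∷ _} (x∉xs ∷ _)  {zero}  {suc j} eq = ⊥-elim (All.lookup x∉xs (∈-lookup j) eq)
  lookup-injective {_ ∷ _} (x∉xs ∷ _)  {suc i} {zero}  eq =
    ⊥-elim (All.lookup x∉xs (∈-lookup i) (≡.sym eq))
  lookup-injective {_ ∷ _} (_ ∷ xs!)   {suc i} {suc j} eq = cong suc (lookup-injective xs! eq)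

  ≤-length⇒∈-injection : ∀ {m} {xs : List A} → Unique xs → m ≤ length xs →
    Σ (Fin m → A) λ f → Injective _≡_ _≡_ f × (∀ i → f i ∈ xs)
  ≤-length⇒∈-injection {xs = xs} xs! m≤ =
    (λ i → lookup xs (inject≤ i m≤)) ,
    (λ eq → inject≤-injective m≤ m≤ _ _ (lookup-injective xs! eq)) ,
    (λ i → ∈-lookup (inject≤ i m≤))

indicator : Bool → ℕ
indicator true  = 1
indicator false = 0

module _ {a p : Level} {A : Set a} {P : Pred A p} (P? : Decidable P) where

  count : List A → ℕ
  count []       = 0
  count (x ∷ xs) = indicator (does (P? x)) + count xs

  count≡length-filter : ∀ xs → count xs ≡ length (filter P? xs)
  count≡length-filter []       = refl
  count≡length-filter (x ∷ xs) with does (P? x)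
  ... | true  = cong suc (count≡length-filter xs)
  ... | false = count≡length-filter xs

path-indicator-bound : ∀ a b c d e →
  indicator (a ∧ b) + indicator (b ∧ c) + indicator (c ∧ d) + indicator (d ∧ e)
  ≤ indicator (a ∧ c) + indicator (b ∧ d) + indicator (c ∧ e) + 1
path-indicator-bound true true true true true = ≤ᵇ⇒≤ _ _ _
path-indicator-bound true true true true false = ≤ᵇ⇒≤ _ _ _
path-indicator-bound true true true false true = ≤ᵇ⇒≤ _ _ _
path-indicator-bound true true true false false = ≤ᵇ⇒≤ _ _ _
path-indicator-bound true true false true true = ≤ᵇ⇒≤ _ _ _
path-indicator-bound true true false true false = ≤ᵇ⇒≤ _ _ _
path-indicator-bound true true false false true = ≤ᵇ⇒≤ _ _ _
path-indicator-bound true true false false false = ≤ᵇ⇒≤ _ _ _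
path-indicator-bound true false true true true = ≤ᵇ⇒≤ _ _ _
path-indicator-bound true false true true false = ≤ᵇ⇒≤ _ _ _
path-indicator-bound true false true false true = ≤ᵇ⇒≤ _ _ _
path-indicator-bound true false true false false = ≤ᵇ⇒≤ _ _ _
path-indicator-bound true false false true true = ≤ᵇ⇒≤ _ _ _
path-indicator-bound true false false true false = ≤ᵇ⇒≤ _ _ _
path-indicator-bound true false false false true = ≤ᵇ⇒≤ _ _ _
path-indicator-bound true false false false false = ≤ᵇ⇒≤ _ _ _
path-indicator-bound false true true true true = ≤ᵇ⇒≤ _ _ _
path-indicator-bound false true true true false = ≤ᵇ⇒≤ _ _ _
path-indicator-bound false true true false true = ≤ᵇ⇒≤ _ _ _
path-indicator-bound false true true false false = ≤ᵇ⇒≤ _ _ _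
path-indicator-bound false true false true true = ≤ᵇ⇒≤ _ _ _
path-indicator-bound false true false true false = ≤ᵇ⇒≤ _ _ _
path-indicator-bound false true false false true = ≤ᵇ⇒≤ _ _ _
path-indicator-bound false true false false false = ≤ᵇ⇒≤ _ _ _
path-indicator-bound false false true true true = ≤ᵇ⇒≤ _ _ _
path-indicator-bound false false true true false = ≤ᵇ⇒≤ _ _ _
path-indicator-bound false false true false true = ≤ᵇ⇒≤ _ _ _
path-indicator-bound false false true false false = ≤ᵇ⇒≤ _ _ _
path-indicator-bound false false false true true = ≤ᵇ⇒≤ _ _ _
path-indicator-bound false false false true false = ≤ᵇ⇒≤ _ _ _
path-indicator-bound false false false false true = ≤ᵇ⇒≤ _ _ _
path-indicator-bound false false false false false = ≤ᵇ⇒≤ _ _ _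

module _ {a p : Level} {A : Set a} {P₀ P₁ P₂ P₃ P₄ : Pred A p}
  (P₀? : Decidable P₀) (P₁? : Decidable P₁) (P₂? : Decidable P₂)
  (P₃? : Decidable P₃) (P₄? : Decidable P₄) where

  path-intersections-bound : ∀ xs →
    count (P₀? ∩? P₁?) xs + count (P₁? ∩? P₂?) xs + count (P₂? ∩? P₃?) xs + count (P₃? ∩? P₄?) xs ≤
    count (P₀? ∩? P₂?) xs + count (P₁? ∩? P₃?) xs + count (P₂? ∩? P₄?) xs + length xs
  path-intersections-bound [] = z≤n
  path-intersections-bound (x ∷ xs) =
    subst₂ _≤_
      (interchange₄ (at-x P₀? P₁?) (at-x P₁? P₂?) (at-x P₂? P₃?) (at-x P₃? P₄?)
                    (on-xs P₀? P₁?) (on-xs P₁? P₂?) (on-xs P₂? P₃?) (on-xs P₃? P₄?))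
      (interchange₄ (at-x P₀? P₂?) (at-x P₁? P₃?) (at-x P₂? P₄?) 1
                    (on-xs P₀? P₂?) (on-xs P₁? P₃?) (on-xs P₂? P₄?) (length xs))
      (+-mono-≤ (path-indicator-bound (does (P₀? x)) (does (P₁? x)) (does (P₂? x))
                                      (does (P₃? x)) (does (P₄? x)))
                (path-intersections-bound xs))
    where
    at-x on-xs : ∀ {Q R : Pred A p} → Decidable Q → Decidable R → ℕ
    at-x Q? R? = indicator (does ((Q? ∩? R?) x))
    on-xs Q? R? = count (Q? ∩? R?) xs
    interchange₄ : ∀ a₁ a₂ a₃ a₄ b₁ b₂ b₃ b₄ →
      (a₁ + a₂ + a₃ + a₄) + (b₁ + b₂ + b₃ + b₄) ≡ (a₁ + b₁) + (a₂ + b₂) + (a₃ + b₃) + (a₄ + b₄)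
    interchange₄ = solve 8 (λ a₁ a₂ a₃ a₄ b₁ b₂ b₃ b₄ →
      (a₁ :+ a₂ :+ a₃ :+ a₄) :+ (b₁ :+ b₂ :+ b₃ :+ b₄)
        := (a₁ :+ b₁) :+ (a₂ :+ b₂) :+ (a₃ :+ b₃) :+ (a₄ :+ b₄)) refl
      where open +-*-Solver

¬¬-∀-Fin : ∀ {n} {P : Fin n → Set} → (∀ i → ¬ ¬ P i) → ¬ ¬ (∀ i → P i)
¬¬-∀-Fin {zero}  _   k = k λ ()
¬¬-∀-Fin {suc n} ¬¬P k =
  ¬¬P zero λ P₀ → ¬¬-∀-Fin (¬¬P ∘ suc) λ Pₛ → k λ { zero → P₀ ; (suc i) → Pₛ i }

¬¬-decidable : ∀ {n} (R : Fin n → Fin n → Set) → ¬ ¬ (∀ x → Decidable (R x))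
¬¬-decidable R = ¬¬-∀-Fin λ x → ¬¬-∀-Fin λ v → ¬¬-excluded-middle

module _ {n : ℕ} (D : Digraph n) (D? : ∀ x → Decidable (D x)) where

  commonOut : Fin n → Fin n → ℕ
  commonOut x y = count (D? x ∩? D? y) (allFin n)

  competeP⇔≤commonOut : ∀ {p} x y → CompeteP p D x y ⇔ p ≤ commonOut x y
  competeP⇔≤commonOut {p} x y = mk⇔ to from
    where
    xy? = D? x ∩? D? y
    to : CompeteP p D x y → p ≤ commonOut x y
    to (a , a-inj , arcs) = subst (p ≤_) (≡.sym (count≡length-filter xy? (allFin n)))
      (∈-injection⇒≤-length a a-inj (λ i → ∈-filter⁺ xy? (∈-allFin (a i)) (arcs i)))
    from : p ≤ commonOut x y → CompeteP p D x y
    from p≤ with ≤-length⇒∈-injection (Unique-filter⁺ xy? {allFin n} (allFin⁺ n))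
                   (subst (p ≤_) (count≡length-filter xy? (allFin n)) p≤)
    ... | a , a-inj , a∈ = a , a-inj , λ i → proj₂ (∈-filter⁻ xy? {xs = allFin n} (a∈ i))

four-edges-three-gaps⇒≤∸3 : ∀ {p m c₁ c₂ c₃ c₄ e₁ e₂ e₃} →
  p ≤ c₁ → p ≤ c₂ → p ≤ c₃ → p ≤ c₄ → e₁ < p → e₂ < p → e₃ < p →
  c₁ + c₂ + c₃ + c₄ ≤ e₁ + e₂ + e₃ + m → p ≤ m ∸ 3
four-edges-three-gaps⇒≤∸3 {p} {m} {c₁} {c₂} {c₃} {c₄} {e₁} {e₂} {e₃}
  p≤c₁ p≤c₂ p≤c₃ p≤c₄ e₁<p e₂<p e₃<p c≤e+m =
  m+n≤o⇒m≤o∸n p (+-cancelʳ-≤ (e₁ + e₂ + e₃) (p + 3) m (begin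
    p + 3 + (e₁ + e₂ + e₃)         ≡⟨ regroup p e₁ e₂ e₃ ⟩
    p + (suc e₁ + suc e₂ + suc e₃) ≤⟨ +-monoʳ-≤ p (+-mono-≤ (+-mono-≤ e₁<p e₂<p) e₃<p) ⟩
    p + (p + p + p)                ≡⟨ ≡.sym (regroup′ p) ⟩
    p + p + p + p                  ≤⟨ +-mono-≤ (+-mono-≤ (+-mono-≤ p≤c₁ p≤c₂) p≤c₃) p≤c₄ ⟩
    c₁ + c₂ + c₃ + c₄              ≤⟨ c≤e+m ⟩
    e₁ + e₂ + e₃ + m               ≡⟨ +-comm (e₁ + e₂ + e₃) m ⟩
    m + (e₁ + e₂ + e₃)             ∎))
  where
  open ≤-Reasoning
  open +-*-Solver
  regroup : ∀ p e₁ e₂ e₃ → p + 3 + (e₁ + e₂ + e₃) ≡ p + (suc e₁ + suc e₂ + suc e₃)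
  regroup = solve 4 (λ p e₁ e₂ e₃ →
    p :+ con 3 :+ (e₁ :+ e₂ :+ e₃) := p :+ ((con 1 :+ e₁) :+ (con 1 :+ e₂) :+ (con 1 :+ e₃))) refl
  regroup′ : ∀ p → p + p + p + p ≡ p + (p + p + p)
  regroup′ = solve 1 (λ p → p :+ p :+ p :+ p := p :+ (p :+ p :+ p)) refl

-- The ends v₀ and v₄ may coincide.
record ChordlessWalk₄ {n : ℕ} (G : Graph n) : Set where
  field
    v₀ v₁ v₂ v₃ v₄ : Fin n
    v₀~v₁ : Adj G v₀ v₁
    v₁~v₂ : Adj G v₁ v₂
    v₂~v₃ : Adj G v₂ v₃
    v₃~v₄ : Adj G v₃ v₄
    v₀≁v₂ : ¬ Adj G v₀ v₂
    v₁≁v₃ : ¬ Adj G v₁ v₃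
    v₂≁v₄ : ¬ Adj G v₂ v₄
    v₀≢v₂ : v₀ ≢ v₂
    v₁≢v₃ : v₁ ≢ v₃
    v₂≢v₄ : v₂ ≢ v₄

adjacent⇒≢ : ∀ {n} (G : Graph n) {x y} → Adj G x y → x ≢ y
adjacent⇒≢ G {x} x~y refl = irrefl G x x~y

module CompetitionCounts {n p : ℕ} (G : Graph n) {D : Digraph n} (G≡CₚD : IsCp p G D)
  (D? : ∀ x → Decidable (D x)) where

  adjacent⇒≤commonOut : ∀ {x y} → Adj G x y → p ≤ commonOut D D? x y
  adjacent⇒≤commonOut {x} {y} x~y =
    Equivalence.to (competeP⇔≤commonOut D D? x y)
      (Equivalence.to (G≡CₚD x y (adjacent⇒≢ G x~y)) x~y)

  nonadjacent⇒commonOut< : ∀ {x y} → x ≢ y → ¬ Adj G x y → commonOut D D? x y < p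
  nonadjacent⇒commonOut< {x} {y} x≢y x≁y = ≰⇒> λ p≤ →
    x≁y (Equivalence.from (G≡CₚD x y x≢y) (Equivalence.from (competeP⇔≤commonOut D D? x y) p≤))

chordlessWalk⇒Υ⊆[n∸3] : ∀ {n} {G : Graph n} → ChordlessWalk₄ G → UpsilonSubsetOf G (n ∸ 3)
chordlessWalk⇒Υ⊆[n∸3] {n} {G} w p (1≤p , _ , D , G≡CₚD) =
  1≤p , decidable-stable (p ≤? n ∸ 3) (λ p≰ → ¬¬-decidable D (p≰ ∘ bound))
  where
  open ChordlessWalk₄ w
  bound : (∀ x → Decidable (D x)) → p ≤ n ∸ 3
  bound D? = subst (λ m → p ≤ m ∸ 3) (length-tabulate {n = n} (λ i → i))
    (four-edges-three-gaps⇒≤∸3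
      (adjacent⇒≤commonOut v₀~v₁) (adjacent⇒≤commonOut v₁~v₂)
      (adjacent⇒≤commonOut v₂~v₃) (adjacent⇒≤commonOut v₃~v₄)
      (nonadjacent⇒commonOut< v₀≢v₂ v₀≁v₂) (nonadjacent⇒commonOut< v₁≢v₃ v₁≁v₃)
      (nonadjacent⇒commonOut< v₂≢v₄ v₂≁v₄)
      (path-intersections-bound (D? v₀) (D? v₁) (D? v₂) (D? v₃) (D? v₄) (allFin n)))
    where open CompetitionCounts G G≡CₚD D?

module _ {n k : ℕ} {G : Graph n} {R : Fin k → Fin k → Set} (R? : ∀ i j → Dec (R i j))
  {h : Fin k → Fin n} (h-inj : Injective _≡_ _≡_ h) (h-iso : ∀ i j → Adj G (h i) (h j) ⇔ R i j) where

  chordlessWalkOf : (i₀ i₁ i₂ i₃ i₄ : Fin k) →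
    True (R? i₀ i₁) → True (R? i₁ i₂) → True (R? i₂ i₃) → True (R? i₃ i₄) →
    False (R? i₀ i₂) → False (R? i₁ i₃) → False (R? i₂ i₄) →
    False (i₀ ≟ᶠ i₂) → False (i₁ ≟ᶠ i₃) → False (i₂ ≟ᶠ i₄) → ChordlessWalk₄ G
  chordlessWalkOf i₀ i₁ i₂ i₃ i₄ r₀₁ r₁₂ r₂₃ r₃₄ ¬r₀₂ ¬r₁₃ ¬r₂₄ i₀≢i₂ i₁≢i₃ i₂≢i₄ = record
    { v₀ = h i₀ ; v₁ = h i₁ ; v₂ = h i₂ ; v₃ = h i₃ ; v₄ = h i₄
    ; v₀~v₁ = adjacent r₀₁ ; v₁~v₂ = adjacent r₁₂ ; v₂~v₃ = adjacent r₂₃ ; v₃~v₄ = adjacent r₃₄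
    ; v₀≁v₂ = nonadjacent ¬r₀₂ ; v₁≁v₃ = nonadjacent ¬r₁₃ ; v₂≁v₄ = nonadjacent ¬r₂₄
    ; v₀≢v₂ = distinct i₀≢i₂ ; v₁≢v₃ = distinct i₁≢i₃ ; v₂≢v₄ = distinct i₂≢i₄
    }
    where
    adjacent : ∀ {i j} → True (R? i j) → Adj G (h i) (h j)
    adjacent {i} {j} r = Equivalence.from (h-iso i j) (toWitness r)
    nonadjacent : ∀ {i j} → False (R? i j) → ¬ Adj G (h i) (h j)
    nonadjacent {i} {j} ¬r = toWitnessFalse ¬r ∘ Equivalence.to (h-iso i j)
    distinct : ∀ {i j} → False (i ≟ᶠ j) → h i ≢ h j
    distinct i≢j = toWitnessFalse i≢j ∘ h-inj

pathAdj? : ∀ {k} (i j : Fin k) → Dec (PathAdj i j)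
pathAdj? i j = (suc (toℕ i) ≟ⁿ toℕ j) ⊎-dec (suc (toℕ j) ≟ⁿ toℕ i)

cycAdj? : ∀ {k} (i j : Fin k) → Dec (CycAdj {k} i j)
cycAdj? {k} i j =
  (suc (toℕ i) ≟ⁿ toℕ j) ⊎-dec (suc (toℕ j) ≟ⁿ toℕ i)
  ⊎-dec ((suc (toℕ i) ≟ⁿ k) ×-dec (toℕ j ≟ⁿ 0)) ⊎-dec ((suc (toℕ j) ≟ⁿ k) ×-dec (toℕ i ≟ⁿ 0))

inducedP₅⇒chordlessWalk : ∀ {n} {G : Graph n} → HasInducedP4 G → ChordlessWalk₄ G
inducedP₅⇒chordlessWalk (_ , f-inj , f-iso) =
  chordlessWalkOf pathAdj? f-inj f-iso (# 0) (# 1) (# 2) (# 3) (# 4) _ _ _ _ _ _ _ _ _ _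

inducedCycle⇒chordlessWalk : ∀ {n} {G : Graph n} {k} → 4 ≤ k → HasInducedCycle G k → ChordlessWalk₄ G
inducedCycle⇒chordlessWalk {k = 4} (s≤s (s≤s (s≤s (s≤s z≤n)))) (_ , c-inj , c-iso) =
  chordlessWalkOf cycAdj? c-inj c-iso (# 0) (# 1) (# 2) (# 3) (# 0) _ _ _ _ _ _ _ _ _ _
-- C₅ gets its own clause: for a symbolic length 5 + m, cycAdj? (# 2) (# 4) does not compute.
inducedCycle⇒chordlessWalk {k = 5} (s≤s (s≤s (s≤s (s≤s z≤n)))) (_ , c-inj , c-iso) =
  chordlessWalkOf cycAdj? c-inj c-iso (# 0) (# 1) (# 2) (# 3) (# 4) _ _ _ _ _ _ _ _ _ _
inducedCycle⇒chordlessWalk {k = suc (suc (suc (suc (suc (suc _)))))} (s≤s (s≤s (s≤s (s≤s z≤n))))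
  (_ , c-inj , c-iso) =
  chordlessWalkOf cycAdj? c-inj c-iso (# 0) (# 1) (# 2) (# 3) (# 4) _ _ _ _ _ _ _ _ _ _

mainTheorem14 : (n : ℕ) → 4 ≤ n → (G : Graph n) →
    ¬ UpsilonSubsetOf G (n ∸ 3) → Chordal G × ¬ HasInducedP4 G
mainTheorem14 n _ G Υ⊈[n∸3] =
  (λ k 4≤k cycle → Υ⊈[n∸3] (chordlessWalk⇒Υ⊆[n∸3] (inducedCycle⇒chordlessWalk {G = G} 4≤k cycle))) ,
  (λ path → Υ⊈[n∸3] (chordlessWalk⇒Υ⊆[n∸3] (inducedP₅⇒chordlessWalk {G = G} path)))
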